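{- In $\mathrm{PG}(2,q^2)$ consider the unitary polarity $(x,y,z)^\perp = [y^q,x^q,z^q]$ (so points $(x_1,y_1,z_1)$ and $(x_2,y_2,z_2)$ are adjacent iff $x_1y_2^q+y_1x_2^q+z_1z_2^q=0$), let $U_2=(0,1,0)$, and for $\lambda\in\mathbb{F}_q$ let $\mathcal{U}_\lambda$ be the Hermitian curve $\lambda X^{q+1}+X^qY+XY^q+Z^{q+1}=0$. Let $\lambda_1,\lambda_2,\lambda_3 \in \mathbb{F}_q\setminus\{0\}$, not necessarily distinct. If there is a triangle $\{P,Q,R\}$ with $P\in\mathcal{U}_{\lambda_1}$, $Q\in\mathcal{U}_{\lambda_2}$, $R\in\mathcal{U}_{\lambda_3}$ and $U_2\notin\{P,Q,R\}$, then \[\lambda_1\lambda_2+\lambda_2\lambda_3+\lambda_1\lambda_3=0.\]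
   Context: Homogeneous coordinates are over $\mathbb{F}_{q^2}$; $[a,b,c]$ denotes the line $aX+bY+cZ=0$. A triangle is a set of three distinct points, each pair of which is adjacent (equivalently, a self-polar triangle: each vertex has the opposite side as its polar line). -}

module Defs where

open import Level using (Level; suc; _⊔_)
open import Data.Nat using (ℕ) renaming (_^_ to _^ℕ_)
open import Data.Fin using (Fin)
open import Data.Product using (_×_; _,_; ∃)
open import Relation.Binary.PropositionalEquality using (_≡_)
open import Relation.Nullary using (¬_)
open import Function.Bundles using (_↔_)
open import Algebra.Structures using (IsCommutativeRing)

record Field (c : Level) : Set (suc c) where
  infixl 7 _*_
  infixl 6 _+_
  field
    Carrier : Set c
    _+_ _*_ : Carrier → Carrier → Carrier
    -_      : Carrier → Carrier
    0# 1#   : Carrier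
    isCommutativeRing : IsCommutativeRing _≡_ _+_ _*_ -_ 0# 1#
    0≢1     : ¬ (0# ≡ 1#)
    inverse : ∀ x → ¬ (x ≡ 0#) → ∃ λ y → x * y ≡ 1#

  _^_ : Carrier → ℕ → Carrier
  x ^ ℕ.zero  = 1#
  x ^ ℕ.suc n = x * (x ^ n)

record FiniteField (c : Level) (n : ℕ) : Set (suc c) where
  field
    field′ : Field c
  open Field field′ public
  field
    card : Carrier ↔ Fin n

module PlaneGeometry {c : Level} (q : ℕ) (K : FiniteField c (q ^ℕ 2)) where
  open FiniteField K

  frob : Carrier → Carrier
  frob x = x ^ q

  InFq : Carrier → Set c
  InFq x = x ^ q ≡ x

  -- homogeneous coordinate triples; points of PG(2,q^2) are nonzero triples
  -- up to nonzero scalar multiples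
  Triple : Set c
  Triple = Carrier × Carrier × Carrier

  NonZeroTriple : Triple → Set c
  NonZeroTriple (x , y , z) = ¬ (x ≡ 0# × y ≡ 0# × z ≡ 0#)

  SamePoint : Triple → Triple → Set c
  SamePoint (x₁ , y₁ , z₁) (x₂ , y₂ , z₂) =
    ∃ λ t → ¬ (t ≡ 0#) × (x₂ ≡ t * x₁ × y₂ ≡ t * y₁ × z₂ ≡ t * z₁)

  Adjacent : Triple → Triple → Set c
  Adjacent (x₁ , y₁ , z₁) (x₂ , y₂ , z₂) =
    x₁ * frob y₂ + y₁ * frob x₂ + z₁ * frob z₂ ≡ 0#

  U₂ : Triple
  U₂ = 0# , 1# , 0#

  OnCurve : Carrier → Triple → Set c
  OnCurve λ′ (x , y , z) =
    λ′ * x ^ (ℕ.suc q) + frob x * y + x * frob y + z ^ (ℕ.suc q) ≡ 0#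

  IsTriangle : Triple → Triple → Triple → Set c
  IsTriangle P Q R =
    (NonZeroTriple P × NonZeroTriple Q × NonZeroTriple R) ×
    (¬ SamePoint P Q × ¬ SamePoint Q R × ¬ SamePoint P R) ×
    (Adjacent P Q × Adjacent Q R × Adjacent P R)

-- The vertices P₁, P₂, P₃ of the triangle are pairwise orthogonal for the Hermitian form
-- h(P, Q) = x_P σ(y_Q) + y_P σ(x_Q) + z_P σ(z_Q), σ(x) = x^q, and a point P of 𝒰_λ satisfies
-- h(P, P) = -λ x_P σ(x_P); the condition U₂ ∉ {P, Q, R} makes every x_P nonzero.  Cramer's
-- rule applied to the x-coordinate, which is h( · , U₂), gives det(P₁,P₂,P₃) = -λᵢ xᵢ Aᵢ for the
-- cofactors Aᵢ of the y-column, while Σ xᵢ Aᵢ = 0 (a determinant with two equal columns).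
-- Hence Σ 1/λᵢ = 0, which is the claim after multiplying by λ₁λ₂λ₃.  The determinant is nonzero
-- because, up to sign, det(P) det(σP) is the determinant of the diagonal Gram matrix (h(Pᵢ, Pⱼ)).
--
-- Orthogonality is given in one direction only; symmetry of h needs σ to be additive, i.e. q a
-- power of the characteristic p.  This holds because a finite field has order p^m (count the
-- elements spanned by a maximal 𝔽_p-independent family) and q ∣ q² = p^m.

module Submission where

open import Defs
open import Level using (Level)
open import Data.Nat using (ℕ) renaming (_^_ to _^ℕ_)
open import Data.Nat as ℕ using (zero; suc; _<_; _≤_; _!; NonZero)
import Data.Nat.Properties as ℕ
open import Data.Nat.Induction using (<-rec)
open import Data.Nat.DivMod using (_%_; _/_; _mod_; m≡m%n+[m/n]*n; m/n*n≡m)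
open import Data.Nat.Divisibility using (_∣_; divides; _∣?_; ∣1⇒≡1; *-cancelʳ-∣; m∣m*n; >⇒∤)
open import Data.Nat.Primality
  using (Prime; prime?; ¬prime[1]; ¬prime⇒composite; composite; euclidsLemma; prime⇒irreducible;
         prime⇒nonZero; prime⇒nonTrivial)
open import Data.Nat.Coprimality using (Coprime; coprime-divisor; prime⇒coprime; coprime-Bézout)
open import Data.Nat.GCD using (module Bézout)
open import Data.Nat.Combinatorics using (_C_; nCk≡n!/k![n-k]!; k![n∸k]!∣n!; nCn≡1)
open import Data.Integer as ℤ using (ℤ; -[1+_]; _⊖_; _◃_; sign; ∣_∣)
import Data.Integer.Properties as ℤ
open import Data.Sign as Sign using (Sign)
open import Data.Fin as Fin using (Fin; toℕ; funToFin; finToFun)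
import Data.Fin.Properties as Fin
open import Data.Fin.Patterns using (0F; 1F; 2F)
open import Data.Vec.Functional using ([]; _∷_)
open import Data.Maybe using (Maybe; just; nothing)
open import Data.Product using (∃; _×_; _,_; proj₁; proj₂)
open import Data.Sum using (inj₁; inj₂)
open import Data.Empty using (⊥-elim)
open import Relation.Nullary using (¬_; Dec; yes; no)
open import Relation.Binary.Definitions using (DecidableEquality; tri<; tri≈; tri>)
open import Relation.Binary.PropositionalEquality
open import Function.Bundles using (Inverse; _↔_; mk↔ₛ′)
open import Function.Definitions using (Injective)
open import Function.Construct.Composition using (_↔-∘_)
open import Function.Construct.Symmetry using (↔-sym)
open import Algebra.Bundles using (CommutativeRing)
open import Algebra.Structures using (IsCommutativeRing)
open import Algebra.Solver.Ring.AlmostCommutativeRing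
  using (fromCommutativeRing; _-Raw-AlmostCommutative⟶_)
import Algebra.Properties.CommutativeSemiring.Binomial

-- The ring solver needs coefficients with decidable equality, so they are taken from ℤ and
-- interpreted in the ring; the type-checking-optimised multiple _×′_ makes 1 ×′ 1# reduce to 1#.
module IntegerRingSolver
  {c : Level} {A : Set c} {add mul : A → A → A} {neg : A → A} {zero₀ one₀ : A}
  (isCommutativeRing : IsCommutativeRing _≡_ add mul neg zero₀ one₀) where

  commutativeRing : CommutativeRing c c
  commutativeRing = record { isCommutativeRing = isCommutativeRing }

  open CommutativeRing commutativeRing
    using (_+_; _*_; -_; 0#; 1#; +-comm; +-identityˡ; +-identityʳ; *-identityˡ; *-identityʳ; zeroʳ;
           -‿inverseʳ; ring; semiring; +-monoid; *-commutativeSemigroup; +-commutativeSemigroup)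
  open import Algebra.Properties.CommutativeSemigroup *-commutativeSemigroup using (interchange)
  open import Algebra.Properties.CommutativeSemigroup +-commutativeSemigroup using ()
    renaming (interchange to +-interchange)
  open import Algebra.Properties.Ring ring
    using (-‿involutive; -‿distribʳ-*; -‿+-comm; -0#≈0#; -1*x≈-x)
  open import Algebra.Properties.Monoid.Mult.TCOptimised +-monoid using (1+×; ×-homo-+) renaming (_×_ to _×′_)
  open import Algebra.Properties.Semiring.Mult.TCOptimised semiring using (×1-homo-*)
  open ≡-Reasoning

  ⟦_⟧ : ℤ → A
  ⟦ ℤ.+ n ⟧      = n ×′ 1#
  ⟦ -[1+ n ] ⟧ = - (suc n ×′ 1#)

  ⟦_⟧ˢ : Sign → A
  ⟦ Sign.+ ⟧ˢ = 1#
  ⟦ Sign.- ⟧ˢ = - 1#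

  ⟦⟧ˢ-homo-* : ∀ s t → ⟦ s Sign.* t ⟧ˢ ≡ ⟦ s ⟧ˢ * ⟦ t ⟧ˢ
  ⟦⟧ˢ-homo-* Sign.- Sign.- = begin
    1#            ≡⟨ sym (-‿involutive 1#) ⟩
    - (- 1#)      ≡⟨ cong -_ (sym (-1*x≈-x 1#)) ⟩
    - (- 1# * 1#) ≡⟨ -‿distribʳ-* (- 1#) 1# ⟩
    - 1# * - 1#   ∎
  ⟦⟧ˢ-homo-* Sign.- Sign.+ = sym (*-identityʳ _)
  ⟦⟧ˢ-homo-* Sign.+ t      = sym (*-identityˡ _)

  ⟦◃⟧ : ∀ s n → ⟦ s ◃ n ⟧ ≡ ⟦ s ⟧ˢ * (n ×′ 1#)
  ⟦◃⟧ s        zero    = sym (zeroʳ _)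
  ⟦◃⟧ Sign.+ (suc n) = sym (*-identityˡ _)
  ⟦◃⟧ Sign.- (suc n) = sym (-1*x≈-x _)

  ⟦⟧-sign-abs : ∀ i → ⟦ i ⟧ ≡ ⟦ sign i ⟧ˢ * (∣ i ∣ ×′ 1#)
  ⟦⟧-sign-abs i = trans (cong ⟦_⟧ (sym (ℤ.◃-inverse i))) (⟦◃⟧ (sign i) ∣ i ∣)

  *-homo : ∀ i j → ⟦ i ℤ.* j ⟧ ≡ ⟦ i ⟧ * ⟦ j ⟧
  *-homo i j = begin
    ⟦ i ℤ.* j ⟧
      ≡⟨ ⟦◃⟧ (sign i Sign.* sign j) (∣ i ∣ ℕ.* ∣ j ∣) ⟩
    ⟦ sign i Sign.* sign j ⟧ˢ * ((∣ i ∣ ℕ.* ∣ j ∣) ×′ 1#)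
      ≡⟨ cong₂ _*_ (⟦⟧ˢ-homo-* (sign i) (sign j)) (×1-homo-* ∣ i ∣ ∣ j ∣) ⟩
    (⟦ sign i ⟧ˢ * ⟦ sign j ⟧ˢ) * ((∣ i ∣ ×′ 1#) * (∣ j ∣ ×′ 1#))
      ≡⟨ interchange _ _ _ _ ⟩
    (⟦ sign i ⟧ˢ * (∣ i ∣ ×′ 1#)) * (⟦ sign j ⟧ˢ * (∣ j ∣ ×′ 1#))
      ≡⟨ sym (cong₂ _*_ (⟦⟧-sign-abs i) (⟦⟧-sign-abs j)) ⟩
    ⟦ i ⟧ * ⟦ j ⟧ ∎

  -‿homo : ∀ i → ⟦ ℤ.- i ⟧ ≡ - ⟦ i ⟧
  -‿homo -[1+ n ]    = sym (-‿involutive _)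
  -‿homo (ℤ.+ zero) = sym -0#≈0#
  -‿homo (ℤ.+ (suc n)) = refl

  ⊖-homo : ∀ m n → ⟦ m ⊖ n ⟧ ≡ m ×′ 1# + - (n ×′ 1#)
  ⊖-homo m zero = begin
    ⟦ m ⊖ zero ⟧     ≡⟨ cong ⟦_⟧ (ℤ.⊖-≥ {m} {zero} ℕ.z≤n) ⟩
    m ×′ 1#           ≡⟨ sym (+-identityʳ _) ⟩
    m ×′ 1# + 0#      ≡⟨ cong (m ×′ 1# +_) (sym -0#≈0#) ⟩
    m ×′ 1# + - 0#    ∎
  ⊖-homo zero (suc n) = sym (+-identityˡ _)
  ⊖-homo (suc m) (suc n) = begin
    ⟦ suc m ⊖ suc n ⟧                ≡⟨ cong ⟦_⟧ (ℤ.[1+m]⊖[1+n]≡m⊖n m n) ⟩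
    ⟦ m ⊖ n ⟧                        ≡⟨ ⊖-homo m n ⟩
    a + - b                          ≡⟨ sym (+-identityˡ _) ⟩
    0# + (a + - b)                   ≡⟨ cong (_+ (a + - b)) (sym (-‿inverseʳ 1#)) ⟩
    (1# + - 1#) + (a + - b)          ≡⟨ +-interchange 1# (- 1#) a (- b) ⟩
    (1# + a) + (- 1# + - b)          ≡⟨ cong ((1# + a) +_) (-‿+-comm 1# b) ⟩
    (1# + a) + - (1# + b)            ≡⟨ sym (cong₂ (λ s t → s + - t) (1+× m 1#) (1+× n 1#)) ⟩
    suc m ×′ 1# + - (suc n ×′ 1#)    ∎
    where
    a = m ×′ 1#
    b = n ×′ 1#

  +-homo : ∀ i j → ⟦ i ℤ.+ j ⟧ ≡ ⟦ i ⟧ + ⟦ j ⟧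
  +-homo -[1+ m ] -[1+ n ] = begin
    - (suc (suc (m ℕ.+ n)) ×′ 1#)         ≡⟨ cong (λ k → - (suc k ×′ 1#)) (sym (ℕ.+-suc m n)) ⟩
    - ((suc m ℕ.+ suc n) ×′ 1#)           ≡⟨ cong -_ (×-homo-+ 1# (suc m) (suc n)) ⟩
    - (suc m ×′ 1# + suc n ×′ 1#)          ≡⟨ sym (-‿+-comm _ _) ⟩
    - (suc m ×′ 1#) + - (suc n ×′ 1#)      ∎
  +-homo -[1+ m ] (ℤ.+ n) = trans (⊖-homo n (suc m)) (+-comm _ _)
  +-homo (ℤ.+ m) -[1+ n ] = ⊖-homo m (suc n)
  +-homo (ℤ.+ m) (ℤ.+ n) = ×-homo-+ 1# m n

  morphism : CommutativeRing.rawRing ℤ.+-*-commutativeRing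
             -Raw-AlmostCommutative⟶ fromCommutativeRing commutativeRing
  morphism = record
    { ⟦_⟧ = ⟦_⟧ ; +-homo = +-homo ; *-homo = *-homo ; -‿homo = -‿homo
    ; 0-homo = refl ; 1-homo = refl }

  ⟦⟧-≟ : ∀ i j → Maybe (⟦ i ⟧ ≡ ⟦ j ⟧)
  ⟦⟧-≟ i j with i ℤ.≟ j
  ... | yes i≡j = just (cong ⟦_⟧ i≡j)
  ... | no _    = nothing

  open import Algebra.Solver.Ring _ _ morphism ⟦⟧-≟ public
    using (solve; _:=_; _:+_; _:*_; _:-_; :-_; con)

p∤m! : ∀ {p m} → Prime p → m < p → ¬ p ∣ m !
p∤m! {p} {zero}  pr _   p∣1 = ¬prime[1] (subst Prime (∣1⇒≡1 p∣1) pr)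
p∤m! {p} {suc m} pr m<p p∣m! with euclidsLemma (suc m) (m !) pr p∣m!
... | inj₁ p∣1+m = >⇒∤ m<p p∣1+m
... | inj₂ p∣m!  = p∤m! pr (ℕ.<-trans (ℕ.n<1+n m) m<p) p∣m!

n∣n! : ∀ {n} → .{{NonZero n}} → n ∣ n !
n∣n! {suc n} = m∣m*n (n !)

p∣pCk : ∀ {p k} → Prime p → 0 < k → k < p → p ∣ p C k
p∣pCk {p} {k} pr 0<k k<p
  with euclidsLemma (p C k) ((k !) ℕ.* ((p ℕ.∸ k) !)) pr (subst (p ∣_) (sym pCk*k![p∸k]!≡p!) p∣p!)
  where
  instance _ = ℕ._!*_!≢0 k (p ℕ.∸ k)
  pCk*k![p∸k]!≡p! : (p C k) ℕ.* ((k !) ℕ.* ((p ℕ.∸ k) !)) ≡ p !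
  pCk*k![p∸k]!≡p! = trans (cong (ℕ._* ((k !) ℕ.* ((p ℕ.∸ k) !))) (nCk≡n!/k![n-k]! (ℕ.<⇒≤ k<p)))
                          (m/n*n≡m (k![n∸k]!∣n! (ℕ.<⇒≤ k<p)))
  p∣p! : p ∣ p !
  p∣p! = n∣n! {{prime⇒nonZero pr}}
... | inj₁ p∣pCk = p∣pCk
... | inj₂ p∣k![p∸k]! with euclidsLemma (k !) ((p ℕ.∸ k) !) pr p∣k![p∸k]!
...   | inj₁ p∣k!     = ⊥-elim (p∤m! pr k<p p∣k!)
...   | inj₂ p∣[p∸k]! = ⊥-elim (p∤m! pr (ℕ.∸-monoʳ-< {p} {k} {0} 0<k (ℕ.<⇒≤ k<p)) p∣[p∸k]!)

∣p^m⇒≡p^j : ∀ {p d} m → Prime p → d ∣ p ℕ.^ m → ∃ λ j → d ≡ p ℕ.^ j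
∣p^m⇒≡p^j {p} {d} zero    pr d∣1 = zero , ∣1⇒≡1 d∣1
∣p^m⇒≡p^j {p} {d} (suc m) pr d∣p^[1+m] with p ∣? d
... | yes (divides e d≡e*p) =
  let j , e≡p^j = ∣p^m⇒≡p^j m pr e∣p^m
  in suc j , trans d≡e*p (trans (cong (ℕ._* p) e≡p^j) (ℕ.*-comm (p ℕ.^ j) p))
  where
  instance _ = prime⇒nonZero pr
  e∣p^m : e ∣ p ℕ.^ m
  e∣p^m = *-cancelʳ-∣ p (subst (_∣ p ℕ.^ m ℕ.* p) d≡e*p (subst (d ∣_) (ℕ.*-comm p (p ℕ.^ m)) d∣p^[1+m]))
... | no p∤d = ∣p^m⇒≡p^j m pr (coprime-divisor d⊥p d∣p^[1+m])
  where
  d⊥p : Coprime d p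
  d⊥p (i∣d , i∣p) with prime⇒irreducible pr i∣p
  ... | inj₁ i≡1  = i≡1
  ... | inj₂ refl = ⊥-elim (p∤d i∣d)

n<m^n : ∀ {m} → 1 < m → ∀ n → n < m ℕ.^ n
n<m^n 1<m zero        = ℕ.z<s
n<m^n {m} 1<m (suc n) = ℕ.≤-<-trans (n<m^n 1<m n) (ℕ.^-monoʳ-< m 1<m (ℕ.n<1+n n))

funToFin-cong : ∀ {k m} {f g : Fin k → Fin m} → f ≗ g → funToFin f ≡ funToFin g
funToFin-cong {zero}  f≗g = refl
funToFin-cong {suc k} f≗g = cong₂ Fin.combine (f≗g Fin.zero) (funToFin-cong (λ i → f≗g (Fin.suc i)))

module FieldProperties {c : Level} (F : Field c) where

  open Field F
  open IntegerRingSolver isCommutativeRing public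
    using (commutativeRing; solve; _:=_; _:+_; _:*_; _:-_; :-_; con)
  open CommutativeRing commutativeRing public
    using (+-assoc; +-identityˡ; +-identityʳ; *-identityˡ; *-identityʳ; zeroˡ; zeroʳ; *-assoc; *-comm;
           distribʳ; -‿inverseˡ; -‿inverseʳ; +-monoid; semiring; commutativeSemiring;
           *-commutativeMonoid; +-commutativeMonoid)
  open import Algebra.Properties.Monoid.Mult.TCOptimised +-monoid using (1+×; ×-homo-+) renaming (_×_ to _×′_)
  open import Algebra.Properties.Semiring.Mult.TCOptimised semiring using (×1-homo-*)
  open import Algebra.Properties.CommutativeMonoid.Sum *-commutativeMonoid public using () renaming (sum to ∏)
  open ≡-Reasoning

  fromℕ : ℕ → Carrier
  fromℕ m = m ×′ 1#

  fromℕ-suc : ∀ m → fromℕ (suc m) ≡ 1# + fromℕ m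
  fromℕ-suc m = 1+× m 1#

  fromℕ-+ : ∀ m n → fromℕ (m ℕ.+ n) ≡ fromℕ m + fromℕ n
  fromℕ-+ = ×-homo-+ 1#

  fromℕ-* : ∀ m n → fromℕ (m ℕ.* n) ≡ fromℕ m * fromℕ n
  fromℕ-* = ×1-homo-*

  ^-+ : ∀ x m n → x ^ (m ℕ.+ n) ≡ x ^ m * x ^ n
  ^-+ x zero    n = sym (*-identityˡ _)
  ^-+ x (suc m) n = trans (cong (x *_) (^-+ x m n)) (sym (*-assoc _ _ _))

  ^-* : ∀ x m n → x ^ (m ℕ.* n) ≡ (x ^ n) ^ m
  ^-* x zero    n = refl
  ^-* x (suc m) n = trans (^-+ x n (m ℕ.* n)) (cong (x ^ n *_) (^-* x m n))

  ^-distrib-* : ∀ x y n → (x * y) ^ n ≡ x ^ n * y ^ n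
  ^-distrib-* x y zero    = sym (*-identityˡ _)
  ^-distrib-* x y (suc n) = begin
    (x * y) * (x * y) ^ n       ≡⟨ cong ((x * y) *_) (^-distrib-* x y n) ⟩
    (x * y) * (x ^ n * y ^ n)
      ≡⟨ solve 4 (λ x y a b → (x :* y) :* (a :* b) := (x :* a) :* (y :* b)) refl x y (x ^ n) (y ^ n) ⟩
    (x * x ^ n) * (y * y ^ n)   ∎

  *-cancelʳ : ∀ {a b x} → x ≢ 0# → a * x ≡ b * x → a ≡ b
  *-cancelʳ {a} {b} {x} x≢0 ax≡bx with inverse x x≢0
  ... | x⁻¹ , xx⁻¹≡1 = begin
    a                ≡⟨ sym (*-identityʳ a) ⟩
    a * 1#           ≡⟨ cong (a *_) (sym xx⁻¹≡1) ⟩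
    a * (x * x⁻¹)    ≡⟨ sym (*-assoc a x x⁻¹) ⟩
    (a * x) * x⁻¹    ≡⟨ cong (_* x⁻¹) ax≡bx ⟩
    (b * x) * x⁻¹    ≡⟨ *-assoc b x x⁻¹ ⟩
    b * (x * x⁻¹)    ≡⟨ cong (b *_) xx⁻¹≡1 ⟩
    b * 1#           ≡⟨ *-identityʳ b ⟩
    b                ∎

  x*y≡0⇒y≡0 : ∀ {x y} → x ≢ 0# → x * y ≡ 0# → y ≡ 0#
  x*y≡0⇒y≡0 {x} {y} x≢0 xy≡0 = *-cancelʳ x≢0 (trans (*-comm y x) (trans xy≡0 (sym (zeroˡ x))))

  x*y≢0 : ∀ {x y} → x ≢ 0# → y ≢ 0# → x * y ≢ 0#
  x*y≢0 x≢0 y≢0 xy≡0 = y≢0 (x*y≡0⇒y≡0 x≢0 xy≡0)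

  +-cancelˡ : ∀ {a b x} → x + a ≡ x + b → a ≡ b
  +-cancelˡ {a} {b} {x} x+a≡x+b = begin
    a              ≡⟨ solve 2 (λ a x → a := :- x :+ (x :+ a)) refl a x ⟩
    - x + (x + a)  ≡⟨ cong (- x +_) x+a≡x+b ⟩
    - x + (x + b)  ≡⟨ solve 2 (λ b x → :- x :+ (x :+ b) := b) refl b x ⟩
    b              ∎

  -‿≢0 : ∀ {x} → x ≢ 0# → - x ≢ 0#
  -‿≢0 {x} x≢0 -x≡0 = x≢0 (begin
    x        ≡⟨ solve 1 (λ x → x := :- (:- x)) refl x ⟩
    - (- x)  ≡⟨ cong -_ -x≡0 ⟩
    - 0#     ≡⟨ solve 0 (:- con (ℤ.+ 0) := con (ℤ.+ 0)) refl ⟩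
    0#       ∎)

  ∏≢0 : ∀ {m} (f : Fin m → Carrier) → (∀ i → f i ≢ 0#) → ∏ f ≢ 0#
  ∏≢0 {zero}  f f≢0 1≡0 = 0≢1 (sym 1≡0)
  ∏≢0 {suc m} f f≢0 = x*y≢0 (f≢0 Fin.zero) (∏≢0 (λ i → f (Fin.suc i)) (λ i → f≢0 (Fin.suc i)))

  ∏-scale : ∀ a {m} (f : Fin m → Carrier) → ∏ (λ i → a * f i) ≡ a ^ m * ∏ f
  ∏-scale a {zero}  f = sym (*-identityˡ 1#)
  ∏-scale a {suc m} f = begin
    a * f Fin.zero * ∏ (λ i → a * f (Fin.suc i))     ≡⟨ cong (a * f Fin.zero *_) (∏-scale a (λ i → f (Fin.suc i))) ⟩
    a * f Fin.zero * (a ^ m * ∏ (λ i → f (Fin.suc i)))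
      ≡⟨ solve 4 (λ a x y z → a :* x :* (y :* z) := a :* y :* (x :* z)) refl a (f Fin.zero) (a ^ m) _ ⟩
    a * a ^ m * (f Fin.zero * ∏ (λ i → f (Fin.suc i))) ∎

  scaling : ∀ {a} → a ≢ 0# → Carrier ↔ Carrier
  scaling {a} a≢0 with inverse a a≢0
  ... | a⁻¹ , aa⁻¹≡1 = mk↔ₛ′ (a *_) (a⁻¹ *_) (cancel aa⁻¹≡1) (cancel (trans (*-comm a⁻¹ a) aa⁻¹≡1))
    where
    cancel : ∀ {b b′} → b * b′ ≡ 1# → ∀ x → b * (b′ * x) ≡ x
    cancel {b} {b′} bb′≡1 x = trans (sym (*-assoc b b′ x)) (trans (cong (_* x) bb′≡1) (*-identityˡ x))

module PrimeCharacteristic {c : Level} (F : Field c) {p : ℕ} (p-prime : Prime p)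
  (fromℕ[p]≡0 : FieldProperties.fromℕ F p ≡ Field.0# F) where

  open Field F
  open FieldProperties F
  open ≡-Reasoning
  instance _ = prime⇒nonZero p-prime


  fromℕ[a+b*p]≡fromℕ[a] : ∀ a b → fromℕ (a ℕ.+ b ℕ.* p) ≡ fromℕ a
  fromℕ[a+b*p]≡fromℕ[a] a b = begin
    fromℕ (a ℕ.+ b ℕ.* p)       ≡⟨ trans (fromℕ-+ a (b ℕ.* p)) (cong (fromℕ a +_) (fromℕ-* b p)) ⟩
    fromℕ a + fromℕ b * fromℕ p ≡⟨ cong (λ t → fromℕ a + fromℕ b * t) fromℕ[p]≡0 ⟩
    fromℕ a + fromℕ b * 0#      ≡⟨ solve 2 (λ a b → a :+ b :* con (ℤ.+ 0) := a) refl (fromℕ a) (fromℕ b) ⟩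
    fromℕ a                     ∎

  fromℕ-% : ∀ m → fromℕ (m % p) ≡ fromℕ m
  fromℕ-% m = sym (trans (cong fromℕ (m≡m%n+[m/n]*n m p)) (fromℕ[a+b*p]≡fromℕ[a] (m % p) (m / p)))

  fromℕ[p∸1]≡-1 : fromℕ (p ℕ.∸ 1) ≡ - 1#
  fromℕ[p∸1]≡-1 = begin
    fromℕ (p ℕ.∸ 1)                  ≡⟨ solve 1 (λ x → x := (:- con (ℤ.+ 1) :+ con (ℤ.+ 1)) :+ x) refl _ ⟩
    (- 1# + 1#) + fromℕ (p ℕ.∸ 1)    ≡⟨ trans (+-assoc _ _ _) (cong (- 1# +_) (sym (fromℕ-suc (p ℕ.∸ 1)))) ⟩
    - 1# + fromℕ (suc (p ℕ.∸ 1))     ≡⟨ cong (λ k → - 1# + fromℕ k) (ℕ.m+[n∸m]≡n (ℕ.>-nonZero⁻¹ p)) ⟩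
    - 1# + fromℕ p                   ≡⟨ cong (- 1# +_) fromℕ[p]≡0 ⟩
    - 1# + 0#                        ≡⟨ +-identityʳ _ ⟩
    - 1#                             ∎

  -- Bézout for the coprime pair (p , d), read in F where p vanishes.
  fromℕ-invertible : ∀ {d} → 0 < d → d < p → ∃ λ k → fromℕ k * fromℕ d ≡ 1#
  fromℕ-invertible {d} 0<d d<p with coprime-Bézout (prime⇒coprime p-prime {{ℕ.>-nonZero 0<d}} d<p)
  ... | Bézout.-+ x y 1+xp≡yd = y , (begin
    fromℕ y * fromℕ d           ≡⟨ sym (fromℕ-* y d) ⟩
    fromℕ (y ℕ.* d)             ≡⟨ cong fromℕ (sym 1+xp≡yd) ⟩
    fromℕ (1 ℕ.+ x ℕ.* p)       ≡⟨ fromℕ[a+b*p]≡fromℕ[a] 1 x ⟩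
    1#                          ∎)
  ... | Bézout.+- x y 1+yd≡xp = (p ℕ.∸ 1) ℕ.* y , (begin
    fromℕ ((p ℕ.∸ 1) ℕ.* y) * fromℕ d
      ≡⟨ cong (_* fromℕ d) (trans (fromℕ-* (p ℕ.∸ 1) y) (cong (_* fromℕ y) fromℕ[p∸1]≡-1)) ⟩
    - 1# * fromℕ y * fromℕ d
      ≡⟨ solve 2 (λ y d → :- con (ℤ.+ 1) :* y :* d := con (ℤ.+ 1) :+ :- con (ℤ.+ 1) :* (con (ℤ.+ 1) :+ y :* d))
           refl (fromℕ y) (fromℕ d) ⟩
    1# + - 1# * (1# + fromℕ y * fromℕ d) ≡⟨ cong (λ t → 1# + - 1# * t) 1+yd≡0 ⟩
    1# + - 1# * 0#                       ≡⟨ solve 0 (con (ℤ.+ 1) :+ :- con (ℤ.+ 1) :* con (ℤ.+ 0) := con (ℤ.+ 1)) refl ⟩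
    1#                                   ∎)
    where
    1+yd≡0 : 1# + fromℕ y * fromℕ d ≡ 0#
    1+yd≡0 = begin
      1# + fromℕ y * fromℕ d  ≡⟨ sym (trans (fromℕ-+ 1 (y ℕ.* d)) (cong (1# +_) (fromℕ-* y d))) ⟩
      fromℕ (1 ℕ.+ y ℕ.* d)   ≡⟨ cong fromℕ 1+yd≡xp ⟩
      fromℕ (0 ℕ.+ x ℕ.* p)   ≡⟨ fromℕ[a+b*p]≡fromℕ[a] 0 x ⟩
      0#                      ∎

  module Binomial = Algebra.Properties.CommutativeSemiring.Binomial commutativeSemiring
  open Binomial using (binomialTerm)
  open import Algebra.Properties.Semiring.Exp semiring using () renaming (_^_ to _^ₛ_)
  open import Algebra.Properties.Semiring.Mult semiring using (×-assoc-*) renaming (_×_ to _×ᵤ_)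
  open import Algebra.Properties.Monoid.Mult.TCOptimised +-monoid using (×ᵤ≈×)
  open import Algebra.Properties.Monoid.Sum +-monoid using (sum; sum-init-last; sum-replicate-zero; sum-cong-≗)

  ^≡^ₛ : ∀ x m → x ^ m ≡ x ^ₛ m
  ^≡^ₛ x zero    = refl
  ^≡^ₛ x (suc m) = cong (x *_) (^≡^ₛ x m)

  ×ᵤ≡fromℕ* : ∀ m x → m ×ᵤ x ≡ fromℕ m * x
  ×ᵤ≡fromℕ* m x = begin
    m ×ᵤ x          ≡⟨ cong (m ×ᵤ_) (sym (*-identityˡ x)) ⟩
    m ×ᵤ (1# * x)   ≡⟨ sym (×-assoc-* m 1# x) ⟩
    (m ×ᵤ 1#) * x   ≡⟨ cong (_* x) (×ᵤ≈× m 1#) ⟩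
    fromℕ m * x     ∎

  binomialTerm-inner : ∀ x y k → 0 < toℕ k → toℕ k < p → binomialTerm x y p k ≡ 0#
  binomialTerm-inner x y k 0<k k<p with p∣pCk p-prime 0<k k<p
  ... | divides m pCk≡m*p = begin
    (p C toℕ k) ×ᵤ z          ≡⟨ ×ᵤ≡fromℕ* (p C toℕ k) z ⟩
    fromℕ (p C toℕ k) * z     ≡⟨ cong (λ j → fromℕ j * z) pCk≡m*p ⟩
    fromℕ (0 ℕ.+ m ℕ.* p) * z ≡⟨ cong (_* z) (fromℕ[a+b*p]≡fromℕ[a] 0 m) ⟩
    0# * z                    ≡⟨ zeroˡ z ⟩
    0#                        ∎
    where z = Binomial.binomial x y p k

  binomialTerm-first : ∀ x y → binomialTerm x y p Fin.zero ≡ y ^ p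
  binomialTerm-first x y = begin
    1 ×ᵤ (1# * y ^ₛ p)    ≡⟨ ×ᵤ≡fromℕ* 1 _ ⟩
    1# * (1# * y ^ₛ p)    ≡⟨ trans (*-identityˡ _) (*-identityˡ _) ⟩
    y ^ₛ p                ≡⟨ sym (^≡^ₛ y p) ⟩
    y ^ p                 ∎

  binomialTerm-last : ∀ x y → binomialTerm x y p (Fin.fromℕ p) ≡ x ^ p
  binomialTerm-last x y = begin
    binomialTerm x y p (Fin.fromℕ p)
      ≡⟨ ×ᵤ≡fromℕ* (p C toℕ (Fin.fromℕ p)) _ ⟩
    fromℕ (p C toℕ (Fin.fromℕ p)) * (x ^ₛ toℕ (Fin.fromℕ p) * y ^ₛ (p ℕ.∸ toℕ (Fin.fromℕ p)))
      ≡⟨ cong (λ k → fromℕ (p C k) * (x ^ₛ k * y ^ₛ (p ℕ.∸ k))) (Fin.toℕ-fromℕ p) ⟩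
    fromℕ (p C p) * (x ^ₛ p * y ^ₛ (p ℕ.∸ p))
      ≡⟨ cong₂ (λ j k → fromℕ j * (x ^ₛ p * y ^ₛ k)) (nCn≡1 p) (ℕ.n∸n≡0 p) ⟩
    1# * (x ^ₛ p * 1#)
      ≡⟨ trans (*-identityˡ _) (*-identityʳ _) ⟩
    x ^ₛ p
      ≡⟨ sym (^≡^ₛ x p) ⟩
    x ^ p ∎

  frobenius-+ : ∀ x y → (x + y) ^ p ≡ x ^ p + y ^ p
  frobenius-+ x y with p ℕ.∸ 1 | sym (ℕ.suc-pred p)
  ... | p′ | refl = begin
    (x + y) ^ p                                     ≡⟨ trans (^≡^ₛ (x + y) p) (Binomial.theorem p x y) ⟩
    t Fin.zero + sum (λ k → t (Fin.suc k))          ≡⟨ cong (t Fin.zero +_) (sum-init-last (λ k → t (Fin.suc k))) ⟩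
    t Fin.zero + (sum (λ k → t (Fin.suc (Fin.inject₁ k))) + t (Fin.fromℕ p))
      ≡⟨ cong (λ s → t Fin.zero + (s + t (Fin.fromℕ p))) (trans (sum-cong-≗ inner) (sum-replicate-zero p′)) ⟩
    t Fin.zero + (0# + t (Fin.fromℕ p))
      ≡⟨ cong₂ (λ a b → a + (0# + b)) (binomialTerm-first x y) (binomialTerm-last x y) ⟩
    y ^ p + (0# + x ^ p)
      ≡⟨ solve 2 (λ a b → b :+ (con (ℤ.+ 0) :+ a) := a :+ b) refl (x ^ p) (y ^ p) ⟩
    x ^ p + y ^ p                                   ∎
    where
    t = binomialTerm x y p
    inner : ∀ k → t (Fin.suc (Fin.inject₁ k)) ≡ 0#
    inner k = binomialTerm-inner x y _ ℕ.z<s (ℕ.s<s (subst (ℕ._< p′) (sym (Fin.toℕ-inject₁ k)) (Fin.toℕ<n k)))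

  frobenius-^-+ : ∀ j x y → (x + y) ^ (p ℕ.^ j) ≡ x ^ (p ℕ.^ j) + y ^ (p ℕ.^ j)
  frobenius-^-+ zero    x y = trans (*-identityʳ _) (sym (cong₂ _+_ (*-identityʳ x) (*-identityʳ y)))
  frobenius-^-+ (suc j) x y = begin
    (x + y) ^ (p ℕ.* p ℕ.^ j)                  ≡⟨ ^-* (x + y) p (p ℕ.^ j) ⟩
    ((x + y) ^ (p ℕ.^ j)) ^ p                  ≡⟨ cong (_^ p) (frobenius-^-+ j x y) ⟩
    (x ^ (p ℕ.^ j) + y ^ (p ℕ.^ j)) ^ p        ≡⟨ frobenius-+ _ _ ⟩
    (x ^ (p ℕ.^ j)) ^ p + (y ^ (p ℕ.^ j)) ^ p  ≡⟨ sym (cong₂ _+_ (^-* x p (p ℕ.^ j)) (^-* y p (p ℕ.^ j))) ⟩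
    x ^ (p ℕ.* p ℕ.^ j) + y ^ (p ℕ.* p ℕ.^ j)  ∎

module FiniteFieldProperties {c : Level} {n : ℕ} (K : FiniteField c n) where

  open FiniteField K
  open FieldProperties field′
  open Inverse card using () renaming
    (to to index; from to element; strictlyInverseˡ to index-element; strictlyInverseʳ to element-index)
  open ≡-Reasoning

  index-injective : Injective _≡_ _≡_ index
  index-injective {x} {y} eq = begin
    x                    ≡⟨ sym (element-index x) ⟩
    element (index x)    ≡⟨ cong element eq ⟩
    element (index y)    ≡⟨ element-index y ⟩
    y                    ∎

  _≟_ : DecidableEquality Carrier
  x ≟ y with index x Fin.≟ index y
  ... | yes eq = yes (index-injective eq)
  ... | no neq = no (λ x≡y → neq (cong index x≡y))

  ≤-card : ∀ {m} {f : Fin m → Carrier} → Injective _≡_ _≡_ f → m ℕ.≤ n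
  ≤-card f-inj = Fin.injective⇒≤ (λ eq → f-inj (index-injective eq))

  card-≤ : ∀ {m} {f : Carrier → Fin m} → Injective _≡_ _≡_ f → n ℕ.≤ m
  card-≤ {f = f} f-inj = Fin.injective⇒≤ {f = λ i → f (element i)} λ {i} {j} eq → begin
    i                    ≡⟨ sym (index-element i) ⟩
    index (element i)    ≡⟨ cong index (f-inj eq) ⟩
    index (element j)    ≡⟨ index-element j ⟩
    j                    ∎

  inhabited⇒≡suc : Fin n → ∃ λ m → n ≡ suc m
  inhabited⇒≡suc Fin.zero    = _ , refl
  inhabited⇒≡suc (Fin.suc _) = _ , refl

  open import Algebra.Properties.CommutativeMonoid.Sum *-commutativeMonoid
    using () renaming (sum-remove to ∏-remove; sum-permute to ∏-permute; sum-cong-≗ to ∏-cong-≗)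

  orOne : Carrier → Carrier
  orOne x with x ≟ 0#
  ... | yes _ = 1#
  ... | no  _ = x

  orOne-0 : ∀ {x} → x ≡ 0# → orOne x ≡ 1#
  orOne-0 {x} x≡0 with x ≟ 0#
  ... | yes _   = refl
  ... | no  x≢0 = ⊥-elim (x≢0 x≡0)

  orOne-≢0 : ∀ {x} → x ≢ 0# → orOne x ≡ x
  orOne-≢0 {x} x≢0 with x ≟ 0#
  ... | yes x≡0 = ⊥-elim (x≢0 x≡0)
  ... | no  _   = refl

  orOne≢0 : ∀ x → orOne x ≢ 0#
  orOne≢0 x with x ≟ 0#
  ... | yes _   = λ 1≡0 → 0≢1 (sym 1≡0)
  ... | no  x≢0 = x≢0

  scale-∏-orOne : ∀ {a m} (f : Fin (suc m) → Carrier) i₀ → a ≢ 0# → f i₀ ≡ 0# →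
                  (∀ j → f (Fin.punchIn i₀ j) ≢ 0#) →
                  a * ∏ (λ i → orOne (a * f i)) ≡ a ^ suc m * ∏ (λ i → orOne (f i))
  scale-∏-orOne {a} {m} f i₀ a≢0 fi₀≡0 f≢0 = begin
    a * ∏ (λ i → orOne (a * f i))
      ≡⟨ cong (a *_) (∏-remove {i = i₀} (λ i → orOne (a * f i))) ⟩
    a * (orOne (a * f i₀) * ∏ (λ j → orOne (a * f (Fin.punchIn i₀ j))))
      ≡⟨ cong₂ (λ s t → a * (s * t)) (orOne-0 (trans (cong (a *_) fi₀≡0) (zeroʳ a))) (∏-cong-≗ scaled) ⟩
    a * (1# * ∏ (λ j → a * rest j))
      ≡⟨ cong (λ t → a * (1# * t)) (∏-scale a rest) ⟩
    a * (1# * (a ^ m * ∏ rest))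
      ≡⟨ solve 4 (λ a b c o → a :* (o :* (b :* c)) := (a :* b) :* (o :* c)) refl a (a ^ m) (∏ rest) 1# ⟩
    a ^ suc m * (1# * ∏ rest)
      ≡⟨ cong (λ t → a ^ suc m * (t * ∏ rest)) (sym (orOne-0 fi₀≡0)) ⟩
    a ^ suc m * (orOne (f i₀) * ∏ rest)
      ≡⟨ cong (a ^ suc m *_) (sym (∏-remove {i = i₀} (λ i → orOne (f i)))) ⟩
    a ^ suc m * ∏ (λ i → orOne (f i)) ∎
    where
    rest : Fin m → Carrier
    rest j = orOne (f (Fin.punchIn i₀ j))
    scaled : ∀ j → orOne (a * f (Fin.punchIn i₀ j)) ≡ a * rest j
    scaled j = trans (orOne-≢0 (x*y≢0 a≢0 (f≢0 j))) (cong (a *_) (sym (orOne-≢0 (f≢0 j))))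

  -- Multiplication by x ≢ 0 permutes K; compare the products of orOne over K before and after.
  x^n≡x : ∀ x → x ^ n ≡ x
  x^n≡x x with x ≟ 0# | inhabited⇒≡suc (index 0#)
  ... | yes refl | m , refl = zeroˡ _
  ... | no x≢0   | m , refl = sym (*-cancelʳ (∏≢0 (λ i → orOne (element i)) (λ i → orOne≢0 _)) (begin
    x * ∏ (λ i → orOne (element i))
      ≡⟨ cong (x *_) (∏-permute (λ i → orOne (element i)) (card ↔-∘ (scaling x≢0 ↔-∘ ↔-sym card))) ⟩
    x * ∏ (λ i → orOne (element (index (x * element i))))
      ≡⟨ cong (x *_) (∏-cong-≗ (λ i → cong orOne (element-index (x * element i)))) ⟩
    x * ∏ (λ i → orOne (x * element i))
      ≡⟨ scale-∏-orOne element (index 0#) x≢0 (element-index 0#) (λ j e≡0 → Fin.punchInᵢ≢i (index 0#) j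
           (trans (sym (index-element _)) (cong index e≡0))) ⟩
    x ^ suc m * ∏ (λ i → orOne (element i)) ∎))

  prime-divisor-vanishes : ∀ d → 0 < d → fromℕ d ≡ 0# → ∃ λ p → Prime p × fromℕ p ≡ 0#
  prime-divisor-vanishes = <-rec (λ d → 0 < d → fromℕ d ≡ 0# → ∃ λ p → Prime p × fromℕ p ≡ 0#) step
    where
    step : ∀ d → (∀ {e} → e < d → 0 < e → fromℕ e ≡ 0# → ∃ λ p → Prime p × fromℕ p ≡ 0#) →
           0 < d → fromℕ d ≡ 0# → ∃ λ p → Prime p × fromℕ p ≡ 0#
    step 1 _ _ 1≡0 = ⊥-elim (0≢1 (sym 1≡0))
    step d@(suc (suc _)) rec _ d≡0 with prime? d
    ... | yes d-prime = d , d-prime , d≡0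
    ... | no ¬d-prime with ¬prime⇒composite ¬d-prime
    ...   | composite {e} e<d (divides f d≡f*e) with fromℕ e ≟ 0#
    ...     | yes e≡0 = rec e<d (ℕ.<-trans ℕ.0<1+n (ℕ.nonTrivial⇒n>1 e)) e≡0
    ...     | no e≢0  = rec f<d 0<f (*-cancelʳ e≢0 (begin
      fromℕ f * fromℕ e   ≡⟨ sym (fromℕ-* f e) ⟩
      fromℕ (f ℕ.* e)     ≡⟨ cong fromℕ (sym d≡f*e) ⟩
      fromℕ d             ≡⟨ d≡0 ⟩
      0#                  ≡⟨ sym (zeroˡ _) ⟩
      0# * fromℕ e        ∎))
      where
      0<f : 0 < f
      0<f = ℕ.n≢0⇒n>0 λ { refl → ℕ.1+n≢0 d≡f*e }
      f<d : f < d
      f<d = subst (f <_) (sym d≡f*e) (ℕ.m<m*n f e {{ℕ.>-nonZero 0<f}} (ℕ.nonTrivial⇒n>1 e))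

  prime-characteristic : ∃ λ p → Prime p × fromℕ p ≡ 0#
  prime-characteristic with Fin.pigeonhole (ℕ.n<1+n n) (λ i → index (fromℕ (toℕ i)))
  ... | i , j , i<j , same-index = prime-divisor-vanishes (toℕ j ℕ.∸ toℕ i) (ℕ.m<n⇒0<n∸m i<j) (+-cancelˡ (begin
    fromℕ (toℕ i) + fromℕ (toℕ j ℕ.∸ toℕ i)  ≡⟨ sym (fromℕ-+ (toℕ i) _) ⟩
    fromℕ (toℕ i ℕ.+ (toℕ j ℕ.∸ toℕ i))      ≡⟨ cong fromℕ (ℕ.m+[n∸m]≡n (ℕ.<⇒≤ i<j)) ⟩
    fromℕ (toℕ j)                             ≡⟨ sym (index-injective same-index) ⟩
    fromℕ (toℕ i)                             ≡⟨ sym (+-identityʳ _) ⟩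
    fromℕ (toℕ i) + 0#                        ∎))

  module PrimePowerOrder {p : ℕ} (p-prime : Prime p) (fromℕ[p]≡0 : fromℕ p ≡ 0#) where
    open PrimeCharacteristic field′ p-prime fromℕ[p]≡0
    open import Algebra.Properties.CommutativeMonoid.Sum +-commutativeMonoid
      using (sum; sum-cong-≗; ∑-distrib-+)
    open import Algebra.Properties.Semiring.Sum semiring using (*-distribˡ-sum)
    instance _ = prime⇒nonZero p-prime

    combination : ∀ {k} → (Fin k → Carrier) → (Fin k → ℕ) → Carrier
    combination e a = sum (λ i → fromℕ (a i) * e i)

    infix 4 _∈Span_
    _∈Span_ : ∀ {k} → Carrier → (Fin k → Carrier) → Set c
    x ∈Span e = ∃ λ a → combination e a ≡ x

    combination-+ : ∀ {k} (e : Fin k → Carrier) a b →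
                    combination e (λ i → a i ℕ.+ b i) ≡ combination e a + combination e b
    combination-+ e a b = trans (sum-cong-≗ (λ i → trans (cong (_* e i) (fromℕ-+ (a i) (b i))) (distribʳ (e i) _ _)))
                                (∑-distrib-+ (λ i → fromℕ (a i) * e i) (λ i → fromℕ (b i) * e i))

    combination-* : ∀ {k} (e : Fin k → Carrier) m a →
                    combination e (λ i → m ℕ.* a i) ≡ fromℕ m * combination e a
    combination-* e m a = trans (sum-cong-≗ (λ i → trans (cong (_* e i) (fromℕ-* m (a i))) (*-assoc _ _ _)))
                                (sym (*-distribˡ-sum (fromℕ m) (λ i → fromℕ (a i) * e i)))

    combination-% : ∀ {k} (e : Fin k → Carrier) a → combination e (λ i → a i % p) ≡ combination e a
    combination-% e a = sum-cong-≗ (λ i → cong (_* e i) (fromℕ-% (a i)))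

    -combination : ∀ {k} (e : Fin k → Carrier) a →
                   - combination e a ≡ combination e (λ i → (p ℕ.∸ 1) ℕ.* a i)
    -combination e a = begin
      - combination e a                       ≡⟨ solve 1 (λ s → :- s := :- con (ℤ.+ 1) :* s) refl _ ⟩
      - 1# * combination e a                  ≡⟨ cong (_* combination e a) (sym fromℕ[p∸1]≡-1) ⟩
      fromℕ (p ℕ.∸ 1) * combination e a       ≡⟨ sym (combination-* e (p ℕ.∸ 1) a) ⟩
      combination e (λ i → (p ℕ.∸ 1) ℕ.* a i) ∎

    ∈Span-cancel : ∀ {k} {e : Fin k → Carrier} {d x} → 0 < d → d < p → fromℕ d * x ∈Span e → x ∈Span e
    ∈Span-cancel {e = e} {d} {x} 0<d d<p (a , a-dx) with fromℕ-invertible 0<d d<p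
    ... | m , md≡1 = (λ i → m ℕ.* a i) , (begin
      combination e (λ i → m ℕ.* a i)  ≡⟨ combination-* e m a ⟩
      fromℕ m * combination e a        ≡⟨ cong (fromℕ m *_) a-dx ⟩
      fromℕ m * (fromℕ d * x)          ≡⟨ sym (*-assoc _ _ _) ⟩
      fromℕ m * fromℕ d * x            ≡⟨ cong (_* x) md≡1 ⟩
      1# * x                           ≡⟨ *-identityˡ x ⟩
      x                                ∎)

    ∈Span-collision : ∀ {k} {e : Fin k → Carrier} {x a b} u v → a < b → b < p →
                      fromℕ a * x + combination e u ≡ fromℕ b * x + combination e v → x ∈Span e
    ∈Span-collision {e = e} {x} {a} {b} u v a<b b<p collision =
      ∈Span-cancel (ℕ.m<n⇒0<n∸m a<b) (ℕ.≤-<-trans (ℕ.m∸n≤m b a) b<p)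
        ((λ i → u i ℕ.+ (p ℕ.∸ 1) ℕ.* v i) , (begin
          combination e (λ i → u i ℕ.+ (p ℕ.∸ 1) ℕ.* v i)  ≡⟨ combination-+ e u _ ⟩
          combination e u + combination e (λ i → (p ℕ.∸ 1) ℕ.* v i)  ≡⟨ cong (combination e u +_) (sym (-combination e v)) ⟩
          combination e u + - combination e v  ≡⟨ cong (_+ - combination e v) u≡dx+v ⟩
          fromℕ (b ℕ.∸ a) * x + combination e v + - combination e v
            ≡⟨ solve 2 (λ s t → s :+ t :- t := s) refl _ (combination e v) ⟩
          fromℕ (b ℕ.∸ a) * x  ∎))
      where
      u≡dx+v : combination e u ≡ fromℕ (b ℕ.∸ a) * x + combination e v
      u≡dx+v = +-cancelˡ (begin
        fromℕ a * x + combination e u                          ≡⟨ collision ⟩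
        fromℕ b * x + combination e v
          ≡⟨ cong (λ k → fromℕ k * x + combination e v) (sym (ℕ.m+[n∸m]≡n (ℕ.<⇒≤ a<b))) ⟩
        fromℕ (a ℕ.+ (b ℕ.∸ a)) * x + combination e v
          ≡⟨ cong (λ t → t * x + combination e v) (fromℕ-+ a (b ℕ.∸ a)) ⟩
        (fromℕ a + fromℕ (b ℕ.∸ a)) * x + combination e v
          ≡⟨ solve 4 (λ a d x s → (a :+ d) :* x :+ s := a :* x :+ (d :* x :+ s)) refl (fromℕ a) _ x _ ⟩
        fromℕ a * x + (fromℕ (b ℕ.∸ a) * x + combination e v)  ∎)

    Independent : ∀ {k} → (Fin k → Carrier) → Set c
    Independent {k} e = ∀ (u v : Fin k → Fin p) →
      combination e (λ i → toℕ (u i)) ≡ combination e (λ i → toℕ (v i)) → u ≗ v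

    toℕ-tail : ∀ {k} → (Fin (suc k) → Fin p) → Fin k → ℕ
    toℕ-tail w i = toℕ (w (Fin.suc i))

    independent-∷ : ∀ {k} {e : Fin k → Carrier} {x} → Independent e → ¬ x ∈Span e → Independent (x ∷ e)
    independent-∷ {e = e} {x} e-indep x∉e u v same with ℕ.<-cmp (toℕ (u Fin.zero)) (toℕ (v Fin.zero))
    ... | tri< a<b _ _ = ⊥-elim (x∉e (∈Span-collision (toℕ-tail u) (toℕ-tail v) a<b (Fin.toℕ<n (v Fin.zero)) same))
    ... | tri> _ _ b<a = ⊥-elim (x∉e (∈Span-collision (toℕ-tail v) (toℕ-tail u) b<a (Fin.toℕ<n (u Fin.zero)) (sym same)))
    ... | tri≈ _ a≡b _ = λ where
      Fin.zero    → Fin.toℕ-injective a≡b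
      (Fin.suc i) → e-indep (λ i → u (Fin.suc i)) (λ i → v (Fin.suc i))
                      (+-cancelˡ (trans same (cong (λ k → fromℕ k * x + _) (sym a≡b)))) i

    digits : ∀ {k} → Fin (p ℕ.^ k) → Fin k → Fin p
    digits = finToFun

    fromDigits : ∀ {k} → (Fin k → Fin p) → Fin (p ℕ.^ k)
    fromDigits = funToFin

    code : ∀ {k} → (Fin k → ℕ) → Fin (p ℕ.^ k)
    code a = fromDigits (λ i → a i mod p)

    decode : ∀ {k} → Fin (p ℕ.^ k) → Fin k → ℕ
    decode j i = toℕ (digits j i)

    combination-decode-code : ∀ {k} (e : Fin k → Carrier) a → combination e (decode (code a)) ≡ combination e a
    combination-decode-code e a = trans
      (sum-cong-≗ (λ i → cong (λ t → fromℕ t * e i)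
        (trans (cong toℕ (Fin.finToFun-funToFin (λ i → a i mod p) i)) (Fin.toℕ-fromℕ< _))))
      (combination-% e a)

    ∈Span? : ∀ {k} (e : Fin k → Carrier) x → Dec (x ∈Span e)
    ∈Span? e x with Fin.any? (λ j → combination e (decode j) ≟ x)
    ... | yes (j , eq) = yes (decode j , eq)
    ... | no ∄j        = no λ (a , eq) → ∄j (code a , trans (combination-decode-code e a) eq)

    independent⇒p^k≤n : ∀ {k} {e : Fin k → Carrier} → Independent e → p ℕ.^ k ≤ n
    independent⇒p^k≤n {k} {e} e-indep = ≤-card {f = λ j → combination e (decode j)} λ {i} {j} same → begin
      i                        ≡⟨ sym (Fin.funToFin-finToFin {k} i) ⟩
      fromDigits (digits {k} i)  ≡⟨ funToFin-cong (e-indep (digits i) (digits j) same) ⟩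
      fromDigits (digits {k} j)  ≡⟨ Fin.funToFin-finToFin {k} j ⟩
      j                        ∎

    spanning⇒n≤p^k : ∀ {k} {e : Fin k → Carrier} → (∀ x → x ∈Span e) → n ≤ p ℕ.^ k
    spanning⇒n≤p^k {k} {e} spans = card-≤ {f = λ x → code (proj₁ (spans x))} λ {x} {y} same → begin
      x                                          ≡⟨ sym (proj₂ (spans x)) ⟩
      combination e (proj₁ (spans x))            ≡⟨ sym (combination-decode-code e _) ⟩
      combination e (decode (code (proj₁ (spans x)))) ≡⟨ cong (λ j → combination e (decode j)) same ⟩
      combination e (decode (code (proj₁ (spans y)))) ≡⟨ combination-decode-code e _ ⟩
      combination e (proj₁ (spans y))            ≡⟨ proj₂ (spans y) ⟩
      y                                          ∎

    -- Extend an independent family by elements outside its span until it spans; independence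
    -- gives k < p^k ≤ n, so the fuel n never runs out.
    grow : ∀ fuel {k} (e : Fin k → Carrier) → Independent e → n ≤ k ℕ.+ fuel → ∃ λ m → n ≡ p ℕ.^ m
    grow zero    {k} e e-indep n≤k = ⊥-elim (ℕ.<⇒≱ (n<m^n (ℕ.nonTrivial⇒n>1 p {{prime⇒nonTrivial p-prime}}) k)
      (ℕ.≤-trans (independent⇒p^k≤n e-indep) (subst (n ≤_) (ℕ.+-identityʳ k) n≤k)))
    grow (suc fuel) {k} e e-indep n≤ with Fin.all? (λ j → ∈Span? e (element j))
    ... | yes spans = k , ℕ.≤-antisym (spanning⇒n≤p^k (λ x → subst (_∈Span e) (element-index x) (spans (index x))))
                                      (independent⇒p^k≤n e-indep)
    ... | no ¬spans = let j , j∉e = Fin.¬∀⟶∃¬ n _ (λ j → ∈Span? e (element j)) ¬spans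
                      in grow fuel (element j ∷ e) (independent-∷ e-indep j∉e) (subst (n ≤_) (ℕ.+-suc k fuel) n≤)

    order-prime-power : ∃ λ m → n ≡ p ℕ.^ m
    order-prime-power = grow n (λ ()) (λ u v _ ()) ℕ.≤-refl

  ^-distrib-+ : ∀ {q} → q ∣ n → ∀ x y → (x + y) ^ q ≡ x ^ q + y ^ q
  ^-distrib-+ {q} q∣n x y with prime-characteristic
  ... | p , p-prime , fromℕ[p]≡0 with PrimePowerOrder.order-prime-power p-prime fromℕ[p]≡0
  ...   | m , n≡p^m with ∣p^m⇒≡p^j m p-prime (subst (q ∣_) n≡p^m q∣n)
  ...     | j , refl = PrimeCharacteristic.frobenius-^-+ field′ p-prime fromℕ[p]≡0 j x y

module Pairing {c : Level} (F : Field c) where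

  open Field F
  open FieldProperties F
  open ≡-Reasoning

  Vector3 : Set c
  Vector3 = Carrier × Carrier × Carrier

  xcoord : Vector3 → Carrier
  xcoord (x , _ , _) = x

  pairing : Vector3 → Vector3 → Carrier
  pairing (x , y , z) (X , Y , Z) = x * Y + y * X + z * Z

  det : Vector3 → Vector3 → Vector3 → Carrier
  det (a , b , c) (d , e , f) (g , h , i) = a * (e * i + - (f * h)) + - (b * (d * i + - (f * g))) + c * (d * h + - (e * g))

  cofactor : Vector3 → Vector3 → Carrier
  cofactor (x , _ , z) (x′ , _ , z′) = z * x′ + - (x * z′)

  det-rotate : ∀ P₁ P₂ P₃ → det P₁ P₂ P₃ ≡ det P₂ P₃ P₁
  det-rotate (a , b , c) (d , e , f) (g , h , i) = solve 9 (λ a b c d e f g h i →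
      a :* (e :* i :- f :* h) :- b :* (d :* i :- f :* g) :+ c :* (d :* h :- e :* g) :=
      d :* (h :* c :- i :* b) :- e :* (g :* c :- i :* a) :+ f :* (g :* b :- h :* a))
    refl a b c d e f g h i

  -- Cramer's rule along the y-column, read through the pairing.
  cramer : ∀ P₁ P₂ P₃ Q →
    det P₁ P₂ P₃ * xcoord Q ≡
      cofactor P₂ P₃ * pairing P₁ Q + cofactor P₃ P₁ * pairing P₂ Q + cofactor P₁ P₂ * pairing P₃ Q
  cramer (x₁ , y₁ , z₁) (x₂ , y₂ , z₂) (x₃ , y₃ , z₃) (X , Y , Z) =
    solve 12 (λ x₁ y₁ z₁ x₂ y₂ z₂ x₃ y₃ z₃ X Y Z →
      (x₁ :* (y₂ :* z₃ :- z₂ :* y₃) :- y₁ :* (x₂ :* z₃ :- z₂ :* x₃) :+ z₁ :* (x₂ :* y₃ :- y₂ :* x₃)) :* X :=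
        (z₂ :* x₃ :- x₂ :* z₃) :* (x₁ :* Y :+ y₁ :* X :+ z₁ :* Z)
      :+ (z₃ :* x₁ :- x₃ :* z₁) :* (x₂ :* Y :+ y₂ :* X :+ z₂ :* Z)
      :+ (z₁ :* x₂ :- x₁ :* z₂) :* (x₃ :* Y :+ y₃ :* X :+ z₃ :* Z))
    refl x₁ y₁ z₁ x₂ y₂ z₂ x₃ y₃ z₃ X Y Z

  cofactor-sum : ∀ P₁ P₂ P₃ →
    xcoord P₁ * cofactor P₂ P₃ + xcoord P₂ * cofactor P₃ P₁ + xcoord P₃ * cofactor P₁ P₂ ≡ 0#
  cofactor-sum (x₁ , _ , z₁) (x₂ , _ , z₂) (x₃ , _ , z₃) = solve 6 (λ x₁ z₁ x₂ z₂ x₃ z₃ →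
      x₁ :* (z₂ :* x₃ :- x₂ :* z₃) :+ x₂ :* (z₃ :* x₁ :- x₃ :* z₁) :+ x₃ :* (z₁ :* x₂ :- x₁ :* z₂) := con (ℤ.+ 0))
    refl x₁ z₁ x₂ z₂ x₃ z₃

  swap : Vector3 → Vector3
  swap (x , y , z) = y , x , z

  det-* : ∀ P₁ P₂ P₃ Q₁ Q₂ Q₃ →
    det P₁ P₂ P₃ * det (swap Q₁) (swap Q₂) (swap Q₃) ≡
    det (pairing P₁ Q₁ , pairing P₁ Q₂ , pairing P₁ Q₃)
        (pairing P₂ Q₁ , pairing P₂ Q₂ , pairing P₂ Q₃)
        (pairing P₃ Q₁ , pairing P₃ Q₂ , pairing P₃ Q₃)
  det-* (a , b , c) (d , e , f) (g , h , i) (b′ , a′ , c′) (e′ , d′ , f′) (h′ , g′ , i′) =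
    solve 18 (λ a b c d e f g h i a′ b′ c′ d′ e′ f′ g′ h′ i′ →
      let dt : _ → _ → _ → _ → _ → _ → _ → _ → _ → _
          dt a b c d e f g h i = a :* (e :* i :- f :* h) :- b :* (d :* i :- f :* g) :+ c :* (d :* h :- e :* g)
      in dt a b c d e f g h i :* dt a′ b′ c′ d′ e′ f′ g′ h′ i′ :=
         dt (a :* a′ :+ b :* b′ :+ c :* c′) (a :* d′ :+ b :* e′ :+ c :* f′) (a :* g′ :+ b :* h′ :+ c :* i′)
            (d :* a′ :+ e :* b′ :+ f :* c′) (d :* d′ :+ e :* e′ :+ f :* f′) (d :* g′ :+ e :* h′ :+ f :* i′)
            (g :* a′ :+ h :* b′ :+ i :* c′) (g :* d′ :+ h :* e′ :+ i :* f′) (g :* g′ :+ h :* h′ :+ i :* i′))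
    refl a b c d e f g h i a′ b′ c′ d′ e′ f′ g′ h′ i′

  det-diagonal : ∀ a e i → det (a , 0# , 0#) (0# , e , 0#) (0# , 0# , i) ≡ a * e * i
  det-diagonal a e i = solve 3 (λ a e i →
      a :* (e :* i :- con (ℤ.+ 0) :* con (ℤ.+ 0)) :- con (ℤ.+ 0) :* (con (ℤ.+ 0) :* i :- con (ℤ.+ 0) :* con (ℤ.+ 0))
        :+ con (ℤ.+ 0) :* (con (ℤ.+ 0) :* con (ℤ.+ 0) :- e :* con (ℤ.+ 0)) := a :* e :* i)
    refl a e i

  det-via-orthogonal : ∀ {P₁ P₂ P₃ Q} → pairing P₂ Q ≡ 0# → pairing P₃ Q ≡ 0# →
    det P₁ P₂ P₃ * xcoord Q ≡ cofactor P₂ P₃ * pairing P₁ Q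
  det-via-orthogonal {P₁} {P₂} {P₃} {Q} P₂⊥Q P₃⊥Q = begin
    det P₁ P₂ P₃ * xcoord Q
      ≡⟨ cramer P₁ P₂ P₃ Q ⟩
    A₁ * pairing P₁ Q + A₂ * pairing P₂ Q + A₃ * pairing P₃ Q
      ≡⟨ cong₂ (λ s t → A₁ * pairing P₁ Q + A₂ * s + A₃ * t) P₂⊥Q P₃⊥Q ⟩
    A₁ * pairing P₁ Q + A₂ * 0# + A₃ * 0#
      ≡⟨ solve 4 (λ a g b c → a :* g :+ b :* con (ℤ.+ 0) :+ c :* con (ℤ.+ 0) := a :* g) refl A₁ (pairing P₁ Q) A₂ A₃ ⟩
    A₁ * pairing P₁ Q ∎
    where
    A₁ = cofactor P₂ P₃
    A₂ = cofactor P₃ P₁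
    A₃ = cofactor P₁ P₂

  -- Σᵢ 1/lᵢ = -Σᵢ cᵢ/d = 0, cleared of denominators.
  reciprocal-sum : ∀ {l₁ l₂ l₃ c₁ c₂ c₃ d} → d ≡ - (l₁ * c₁) → d ≡ - (l₂ * c₂) → d ≡ - (l₃ * c₃) →
    c₁ + c₂ + c₃ ≡ 0# → (l₁ * l₂ + l₂ * l₃ + l₁ * l₃) * d ≡ 0#
  reciprocal-sum {l₁} {l₂} {l₃} {c₁} {c₂} {c₃} {d} d≡₁ d≡₂ d≡₃ Σc≡0 = begin
    (l₁ * l₂ + l₂ * l₃ + l₁ * l₃) * d
      ≡⟨ solve 7 (λ l₁ l₂ l₃ d c₁ c₂ c₃ → (l₁ :* l₂ :+ l₂ :* l₃ :+ l₁ :* l₃) :* d :=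
           l₁ :* l₂ :* (d :+ l₃ :* c₃) :+ l₂ :* l₃ :* (d :+ l₁ :* c₁) :+ l₁ :* l₃ :* (d :+ l₂ :* c₂)
             :- l₁ :* l₂ :* l₃ :* (c₁ :+ c₂ :+ c₃)) refl l₁ l₂ l₃ d c₁ c₂ c₃ ⟩
    l₁ * l₂ * (d + l₃ * c₃) + l₂ * l₃ * (d + l₁ * c₁) + l₁ * l₃ * (d + l₂ * c₂) + - (l₁ * l₂ * l₃ * (c₁ + c₂ + c₃))
      ≡⟨ cong₂ _+_ (cong₂ _+_ (cong₂ _+_ (cong (l₁ * l₂ *_) (vanish d≡₃)) (cong (l₂ * l₃ *_) (vanish d≡₁)))
                              (cong (l₁ * l₃ *_) (vanish d≡₂)))
                   (cong (λ t → - (l₁ * l₂ * l₃ * t)) Σc≡0) ⟩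
    l₁ * l₂ * 0# + l₂ * l₃ * 0# + l₁ * l₃ * 0# + - (l₁ * l₂ * l₃ * 0#)
      ≡⟨ solve 3 (λ l₁ l₂ l₃ → l₁ :* l₂ :* con (ℤ.+ 0) :+ l₂ :* l₃ :* con (ℤ.+ 0) :+ l₁ :* l₃ :* con (ℤ.+ 0)
                                  :- l₁ :* l₂ :* l₃ :* con (ℤ.+ 0) := con (ℤ.+ 0)) refl l₁ l₂ l₃ ⟩
    0# ∎
    where
    vanish : ∀ {l c} → d ≡ - (l * c) → d + l * c ≡ 0#
    vanish {l} {c} d≡ = trans (cong (_+ l * c) d≡) (-‿inverseˡ (l * c))

  det-cong : ∀ {R₁ R₂ R₃ R₁′ R₂′ R₃′} → R₁ ≡ R₁′ → R₂ ≡ R₂′ → R₃ ≡ R₃′ →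
    det R₁ R₂ R₃ ≡ det R₁′ R₂′ R₃′
  det-cong refl refl refl = refl

  det≡-cofactor : ∀ {l R₁ R₂ R₃ Q} → xcoord Q ≢ 0# →
    pairing R₁ Q ≡ - (l * (xcoord R₁ * xcoord Q)) → pairing R₂ Q ≡ 0# → pairing R₃ Q ≡ 0# →
    det R₁ R₂ R₃ ≡ - (l * (xcoord R₁ * cofactor R₂ R₃))
  det≡-cofactor {l} {R₁} {R₂} {R₃} {Q} xQ≢0 R₁·Q R₂⊥Q R₃⊥Q = *-cancelʳ xQ≢0 (begin
    det R₁ R₂ R₃ * xcoord Q                        ≡⟨ det-via-orthogonal R₂⊥Q R₃⊥Q ⟩
    cofactor R₂ R₃ * pairing R₁ Q                  ≡⟨ cong (cofactor R₂ R₃ *_) R₁·Q ⟩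
    cofactor R₂ R₃ * - (l * (xcoord R₁ * xcoord Q)) ≡⟨ solve 4 (λ a l x X → a :* (:- (l :* (x :* X))) := :- (l :* (x :* a)) :* X)
                                                         refl (cofactor R₂ R₃) l (xcoord R₁) (xcoord Q) ⟩
    - (l * (xcoord R₁ * cofactor R₂ R₃)) * xcoord Q ∎)

  -- det P · det (swap ∘ Q) is the determinant of the diagonal pairing matrix.
  diagonal-pairing⇒det≢0 : ∀ {g : Fin 3 → Carrier} (P Q : Fin 3 → Vector3) → (∀ i → g i ≢ 0#) →
    (∀ i → pairing (P i) (Q i) ≡ g i) → (∀ {i j} → i ≢ j → pairing (P i) (Q j) ≡ 0#) →
    det (P 0F) (P 1F) (P 2F) ≢ 0#
  diagonal-pairing⇒det≢0 {g} P Q g≢0 diagonal orthogonal d≡0 = x*y≢0 (x*y≢0 (g≢0 0F) (g≢0 1F)) (g≢0 2F) (begin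
    g 0F * g 1F * g 2F
      ≡⟨ sym (det-diagonal (g 0F) (g 1F) (g 2F)) ⟩
    det (g 0F , 0# , 0#) (0# , g 1F , 0#) (0# , 0# , g 2F)
      ≡⟨ sym (det-cong (row (diagonal 0F) (orthogonal λ ()) (orthogonal λ ()))
                       (row (orthogonal λ ()) (diagonal 1F) (orthogonal λ ()))
                       (row (orthogonal λ ()) (orthogonal λ ()) (diagonal 2F))) ⟩
    det (pairing (P 0F) (Q 0F) , pairing (P 0F) (Q 1F) , pairing (P 0F) (Q 2F))
        (pairing (P 1F) (Q 0F) , pairing (P 1F) (Q 1F) , pairing (P 1F) (Q 2F))
        (pairing (P 2F) (Q 0F) , pairing (P 2F) (Q 1F) , pairing (P 2F) (Q 2F))
      ≡⟨ sym (det-* (P 0F) (P 1F) (P 2F) (Q 0F) (Q 1F) (Q 2F)) ⟩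
    det (P 0F) (P 1F) (P 2F) * det-Q′
      ≡⟨ cong (_* det-Q′) d≡0 ⟩
    0# * det-Q′
      ≡⟨ zeroˡ _ ⟩
    0# ∎)
    where
    det-Q′ = det (swap (Q 0F)) (swap (Q 1F)) (swap (Q 2F))
    row : ∀ {a b c a′ b′ c′ : Carrier} → a ≡ a′ → b ≡ b′ → c ≡ c′ → (a , b , c) ≡ (a′ , b′ , c′)
    row refl refl refl = refl

  orthogonal-triangle : ∀ (l : Fin 3 → Carrier) (P Q : Fin 3 → Vector3) →
    (∀ i → l i * (xcoord (P i) * xcoord (Q i)) ≢ 0#) →
    (∀ i → pairing (P i) (Q i) ≡ - (l i * (xcoord (P i) * xcoord (Q i)))) →
    (∀ {i j} → i ≢ j → pairing (P i) (Q j) ≡ 0#) →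
    l 0F * l 1F + l 1F * l 2F + l 0F * l 2F ≡ 0#
  orthogonal-triangle l P Q nondegenerate diagonal orthogonal =
    *-cancelʳ d≢0 (trans (reciprocal-sum d≡₀ d≡₁ d≡₂ (cofactor-sum (P 0F) (P 1F) (P 2F))) (sym (zeroˡ d)))
    where
    d = det (P 0F) (P 1F) (P 2F)
    d≢0 : d ≢ 0#
    d≢0 = diagonal-pairing⇒det≢0 P Q (λ i → -‿≢0 (nondegenerate i)) diagonal orthogonal
    xQ≢0 : ∀ i → xcoord (Q i) ≢ 0#
    xQ≢0 i xQ≡0 = nondegenerate i (trans (cong (λ t → l i * (xcoord (P i) * t)) xQ≡0) (trans (cong (l i *_) (zeroʳ _)) (zeroʳ _)))
    d≡₀ : d ≡ - (l 0F * (xcoord (P 0F) * cofactor (P 1F) (P 2F)))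
    d≡₀ = det≡-cofactor (xQ≢0 0F) (diagonal 0F) (orthogonal λ ()) (orthogonal λ ())
    d≡₁ : d ≡ - (l 1F * (xcoord (P 1F) * cofactor (P 2F) (P 0F)))
    d≡₁ = trans (det-rotate (P 0F) (P 1F) (P 2F)) (det≡-cofactor (xQ≢0 1F) (diagonal 1F) (orthogonal λ ()) (orthogonal λ ()))
    d≡₂ : d ≡ - (l 2F * (xcoord (P 2F) * cofactor (P 0F) (P 1F)))
    d≡₂ = trans (det-rotate (P 0F) (P 1F) (P 2F)) (trans (det-rotate (P 1F) (P 2F) (P 0F))
            (det≡-cofactor (xQ≢0 2F) (diagonal 2F) (orthogonal λ ()) (orthogonal λ ())))

module Hermitian {c : Level} (F : Field c) where

  open Field F
  open FieldProperties F
  open Pairing F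
  open ≡-Reasoning

  module Conjugation (σ : Carrier → Carrier)
    (σ-+ : ∀ x y → σ (x + y) ≡ σ x + σ y)
    (σ-* : ∀ x y → σ (x * y) ≡ σ x * σ y)
    (σ-involutive : ∀ x → σ (σ x) ≡ x) where

    conj : Vector3 → Vector3
    conj (x , y , z) = σ x , σ y , σ z

    σ-0 : σ 0# ≡ 0#
    σ-0 = begin
      σ 0#                      ≡⟨ solve 1 (λ s → s := (s :+ s) :- s) refl (σ 0#) ⟩
      (σ 0# + σ 0#) + - σ 0#    ≡⟨ cong (_+ - σ 0#) (sym (σ-+ 0# 0#)) ⟩
      σ (0# + 0#) + - σ 0#      ≡⟨ cong (λ t → σ t + - σ 0#) (+-identityˡ 0#) ⟩
      σ 0# + - σ 0#             ≡⟨ -‿inverseʳ _ ⟩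
      0#                        ∎

    σ-≢0 : ∀ {x} → x ≢ 0# → σ x ≢ 0#
    σ-≢0 {x} x≢0 σx≡0 = x≢0 (trans (sym (σ-involutive x)) (trans (cong σ σx≡0) σ-0))

    σ-pairing-conj : ∀ P Q → σ (pairing P (conj Q)) ≡ pairing Q (conj P)
    σ-pairing-conj (x , y , z) (x′ , y′ , z′) = begin
      σ (x * σ y′ + y * σ x′ + z * σ z′)
        ≡⟨ trans (σ-+ _ _) (cong (_+ σ (z * σ z′)) (σ-+ _ _)) ⟩
      σ (x * σ y′) + σ (y * σ x′) + σ (z * σ z′)
        ≡⟨ cong₂ _+_ (cong₂ _+_ (σ-* x _) (σ-* y _)) (σ-* z _) ⟩
      σ x * σ (σ y′) + σ y * σ (σ x′) + σ z * σ (σ z′)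
        ≡⟨ cong₂ _+_ (cong₂ _+_ (cong (σ x *_) (σ-involutive y′)) (cong (σ y *_) (σ-involutive x′)))
                     (cong (σ z *_) (σ-involutive z′)) ⟩
      σ x * y′ + σ y * x′ + σ z * z′
        ≡⟨ solve 6 (λ a b c d e f → a :* b :+ c :* d :+ e :* f := d :* c :+ b :* a :+ f :* e)
             refl (σ x) y′ (σ y) x′ (σ z) z′ ⟩
      x′ * σ y + y′ * σ x + z′ * σ z ∎

    pairing-conj-sym : ∀ {P Q} → pairing P (conj Q) ≡ 0# → pairing Q (conj P) ≡ 0#
    pairing-conj-sym {P} {Q} P⊥Q = trans (sym (σ-pairing-conj P Q)) (trans (cong σ P⊥Q) σ-0)

    -- The equation of the curve λX^{q+1} + X^q Y + X Y^q + Z^{q+1} = 0, with X^{q+1} = X · σX.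
    pairing-self : ∀ {l x y z} → l * (x * σ x) + σ x * y + x * σ y + z * σ z ≡ 0# →
      pairing (x , y , z) (conj (x , y , z)) ≡ - (l * (x * σ x))
    pairing-self {l} {x} {y} {z} on-curve = begin
      x * σ y + y * σ x + z * σ z
        ≡⟨ solve 7 (λ l x y z X Y Z → x :* Y :+ y :* X :+ z :* Z := (l :* (x :* X) :+ X :* y :+ x :* Y :+ z :* Z) :- l :* (x :* X))
             refl l x y z (σ x) (σ y) (σ z) ⟩
      (l * (x * σ x) + σ x * y + x * σ y + z * σ z) + - (l * (x * σ x))
        ≡⟨ cong (_+ - (l * (x * σ x))) on-curve ⟩
      0# + - (l * (x * σ x))
        ≡⟨ +-identityˡ _ ⟩
      - (l * (x * σ x)) ∎

module UnitaryPolarity {c : Level} (q : ℕ) (K : FiniteField c (q ^ℕ 2)) where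

  open FiniteField K
  open PlaneGeometry q K
  open FieldProperties field′
  open FiniteFieldProperties K
  open ≡-Reasoning

  frob-+ : ∀ x y → frob (x + y) ≡ frob x + frob y
  frob-+ = ^-distrib-+ {q} (m∣m*n (q ℕ.* 1))

  frob-* : ∀ x y → frob (x * y) ≡ frob x * frob y
  frob-* x y = ^-distrib-* x y q

  frob-involutive : ∀ x → frob (frob x) ≡ x
  frob-involutive x = begin
    (x ^ q) ^ q         ≡⟨ sym (^-* x q q) ⟩
    x ^ (q ℕ.* q)       ≡⟨ cong (λ k → x ^ (q ℕ.* k)) (sym (ℕ.*-identityʳ q)) ⟩
    x ^ (q ^ℕ 2)        ≡⟨ x^n≡x x ⟩
    x                   ∎

  open Pairing field′ public
  open Hermitian.Conjugation field′ frob frob-+ frob-* frob-involutive public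

  -- With x = 0 the curve equation reads z σ(z) = 0, and z = 0 would make P the point U₂.
  off-U₂⇒x≢0 : ∀ {l P} → NonZeroTriple P → OnCurve l P → ¬ SamePoint U₂ P → xcoord P ≢ 0#
  off-U₂⇒x≢0 {l} {x , y , z} P≢0 on-curve P≉U₂ refl = x*y≢0 z≢0 (σ-≢0 z≢0) zσz≡0
    where
    z≢0 : z ≢ 0#
    z≢0 z≡0 = P≉U₂ (y , y≢0 , sym (zeroʳ y) , sym (*-identityʳ y) , trans z≡0 (sym (zeroʳ y)))
      where
      y≢0 : y ≢ 0#
      y≢0 y≡0 = P≢0 (refl , y≡0 , z≡0)
    zσz≡0 : z * frob z ≡ 0#
    zσz≡0 = begin
      z * frob z
        ≡⟨ solve 4 (λ l y Y t → t := l :* (con (ℤ.+ 0) :* con (ℤ.+ 0)) :+ con (ℤ.+ 0) :* y :+ con (ℤ.+ 0) :* Y :+ t)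
             refl l y (frob y) (z * frob z) ⟩
      l * (0# * 0#) + 0# * y + 0# * frob y + z * frob z
        ≡⟨ cong (λ s → l * (0# * s) + s * y + 0# * frob y + z * frob z) (sym σ-0) ⟩
      l * (0# * frob 0#) + frob 0# * y + 0# * frob y + z * frob z
        ≡⟨ on-curve ⟩
      0# ∎

  vertex-nondegenerate : ∀ {l P} → l ≢ 0# → NonZeroTriple P → OnCurve l P → ¬ SamePoint U₂ P →
    l * (xcoord P * frob (xcoord P)) ≢ 0#
  vertex-nondegenerate l≢0 P≢0 on-curve P≉U₂ =
    x*y≢0 l≢0 (x*y≢0 x≢0 (σ-≢0 x≢0))
    where x≢0 = off-U₂⇒x≢0 P≢0 on-curve P≉U₂

  triangle-orthogonal : ∀ {P Q R} → Adjacent P Q → Adjacent Q R → Adjacent P R →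
    ∀ {i j} → i ≢ j → pairing ((P ∷ Q ∷ R ∷ []) i) (conj ((P ∷ Q ∷ R ∷ []) j)) ≡ 0#
  triangle-orthogonal P⊥Q Q⊥R P⊥R {0F} {0F} 0≢0 = ⊥-elim (0≢0 refl)
  triangle-orthogonal P⊥Q Q⊥R P⊥R {0F} {1F} _   = P⊥Q
  triangle-orthogonal P⊥Q Q⊥R P⊥R {0F} {2F} _   = P⊥R
  triangle-orthogonal P⊥Q Q⊥R P⊥R {1F} {0F} _   = pairing-conj-sym P⊥Q
  triangle-orthogonal P⊥Q Q⊥R P⊥R {1F} {1F} 1≢1 = ⊥-elim (1≢1 refl)
  triangle-orthogonal P⊥Q Q⊥R P⊥R {1F} {2F} _   = Q⊥R
  triangle-orthogonal P⊥Q Q⊥R P⊥R {2F} {0F} _   = pairing-conj-sym P⊥R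
  triangle-orthogonal P⊥Q Q⊥R P⊥R {2F} {1F} _   = pairing-conj-sym Q⊥R
  triangle-orthogonal P⊥Q Q⊥R P⊥R {2F} {2F} 2≢2 = ⊥-elim (2≢2 refl)

proposition2 : ∀ {c : Level} (q : ℕ) (K : FiniteField c (q ^ℕ 2)) →
    let open FiniteField K
        open PlaneGeometry q K
    in ∀ (λ₁ λ₂ λ₃ : Carrier) →
       InFq λ₁ → InFq λ₂ → InFq λ₃ →
       ¬ (λ₁ ≡ 0#) → ¬ (λ₂ ≡ 0#) → ¬ (λ₃ ≡ 0#) →
       ∀ (P Q R : Triple) →
       IsTriangle P Q R →
       OnCurve λ₁ P → OnCurve λ₂ Q → OnCurve λ₃ R →
       ¬ SamePoint U₂ P → ¬ SamePoint U₂ Q → ¬ SamePoint U₂ R →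
       λ₁ * λ₂ + λ₂ * λ₃ + λ₁ * λ₃ ≡ 0#
proposition2 q K λ₁ λ₂ λ₃ _ _ _ λ₁≢0 λ₂≢0 λ₃≢0 P Q R ((P≢0 , Q≢0 , R≢0) , _ , (P⊥Q , Q⊥R , P⊥R))
             P∈ Q∈ R∈ P≉U₂ Q≉U₂ R≉U₂ =
  orthogonal-triangle l vertex (λ i → conj (vertex i)) nondegenerate diagonal (triangle-orthogonal P⊥Q Q⊥R P⊥R)
  where
  open FiniteField K
  open UnitaryPolarity q K
  l = λ₁ ∷ λ₂ ∷ λ₃ ∷ []
  vertex = P ∷ Q ∷ R ∷ []
  nondegenerate : ∀ i → l i * (xcoord (vertex i) * xcoord (conj (vertex i))) ≢ 0#
  nondegenerate 0F = vertex-nondegenerate λ₁≢0 P≢0 P∈ P≉U₂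
  nondegenerate 1F = vertex-nondegenerate λ₂≢0 Q≢0 Q∈ Q≉U₂
  nondegenerate 2F = vertex-nondegenerate λ₃≢0 R≢0 R∈ R≉U₂
  diagonal : ∀ i → pairing (vertex i) (conj (vertex i)) ≡ - (l i * (xcoord (vertex i) * xcoord (conj (vertex i))))
  diagonal 0F = pairing-self P∈
  diagonal 1F = pairing-self Q∈
  diagonal 2F = pairing-self R∈
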